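{- Let $G$ be a finite commutative group with $|G|=q$, and let $A\subseteq G$ be a $g$-Sidon set. If $g\ge 2$ is even, then $|A|\le\sqrt{(g-1)q}+1$. If $g\ge 3$ is odd, then $|A|\le\sqrt{(g-2)q}+\frac32+\frac{1}{g-2}$.
   Context: For $A\subseteq G$, the representation function is $r(x)=\#\{(a_1,a_2): a_1,a_2\in A,\ a_1+a_2=x\}$ (ordered pairs). $A$ is a $g$-Sidon set if $r(x)\le g$ for all $x\in G$. -}

module Defs where

open import Data.Nat using (ℕ)
open import Data.Bool using (Bool; _∧_)
open import Data.Fin using (Fin)
open import Data.Fin.Properties using () renaming (_≟_ to _≟ᶠ_)
open import Data.Fin.Subset using (Subset; _∈_)
open import Data.Fin.Subset.Properties using (_∈?_)
open import Data.List using (List; length; filterᵇ; cartesianProduct; allFin)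
open import Data.Product using (_×_; _,_)
open import Relation.Nullary.Decidable using (⌊_⌋)
open import Relation.Binary.PropositionalEquality using (_≡_)
open import Algebra.Structures using (IsAbelianGroup)

-- A finite commutative group of order q, presented (up to isomorphism) with
-- carrier Fin q and propositional equality.
record FiniteAbelianGroup (q : ℕ) : Set where
  field
    _∙_ : Fin q → Fin q → Fin q
    ε   : Fin q
    _⁻¹ : Fin q → Fin q
    isAbelianGroup : IsAbelianGroup (_≡_ {A = Fin q}) _∙_ ε _⁻¹

r : ∀ {q} → FiniteAbelianGroup q → Subset q → Fin q → ℕ
r {q} G A x =
  length (filterᵇ ok (cartesianProduct (allFin q) (allFin q)))
  where
    open FiniteAbelianGroup G
    ok : Fin q × Fin q → Bool
    ok (a₁ , a₂) = ⌊ a₁ ∈? A ⌋ ∧ ⌊ a₂ ∈? A ⌋ ∧ ⌊ (a₁ ∙ a₂) ≟ᶠ x ⌋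

IsSidon : ∀ {q} → FiniteAbelianGroup q → ℕ → Subset q → Set
IsSidon G g A = ∀ x → r G A x Data.Nat.≤ g

module Submission where

-- Write k = |A|, r(x) = #{(a,b) ∈ A² : a·b = x} for the representation
-- function and s(e) = #{(a,b) ∈ A² : a = e·b} for the "difference" function.
-- Both have total mass k², s(ε) = k, and Σₓ r(x)² = Σₑ s(e)² since both sides
-- count the quadruples (a,b,c,d) ∈ A⁴ with a·b = c·d.  Cauchy–Schwarz applied
-- to s away from ε gives  (k² − k)² ≤ q · (Σₓ r(x)² − k²).
-- The Sidon hypothesis r ≤ g bounds Σ r² ≤ g·k².  When g is odd it does better:
-- the swap (a,b) ↦ (b,a) shows r(x) ≡ d(x) (mod 2) with d(x) = #{a ∈ A : a² = x},
-- so r(x) = g forces d(x) ≥ 1 and r(x)² ≤ (g−1)·r(x) + g·d(x); summing gives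
-- Σ r² ≤ (g−1)·k² + g·k.

open import Defs
open import Data.Nat using (ℕ; zero; suc; _≤_; _*_; _+_; _∸_; _^_; z≤n; s≤s)
open import Data.Nat.Properties
open import Data.Nat.Divisibility using (_∣_; divides)
open import Data.Nat.ListAction using () renaming (sum to listSum)
open import Data.Nat.ListAction.Properties using () renaming (sum-++ to listSum-++)
open import Data.Nat.Solver using (module +-*-Solver)
open import Data.Bool using (Bool; true; false; _∧_; if_then_else_)
open import Data.Fin using (Fin; zero; suc)
open import Data.Fin.Properties using () renaming (_≟_ to _≟ᶠ_)
open import Data.Fin.Subset using (Subset; ∣_∣; inside; outside)
open import Data.Fin.Subset.Properties using (_∈?_)
open import Data.Vec using ([]; _∷_)
open import Data.List using (List; []; _∷_; length; filterᵇ; cartesianProduct; allFin; map; tabulate; _++_)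
open import Data.List.Properties using (map-++; map-∘; map-tabulate)
open import Data.Product using (_×_; _,_)
open import Data.Sum using (inj₁; inj₂)
open import Data.Empty using (⊥-elim)
open import Function using (_∘_; id)
open import Level using (0ℓ)
open import Relation.Nullary using (¬_; yes; no)
open import Relation.Nullary.Decidable using (Dec; does; _because_; ⌊_⌋)
open import Relation.Binary.PropositionalEquality
open import Algebra.Bundles using (Group)
open import Algebra.Structures using (IsAbelianGroup)
open import Algebra.Properties.Semiring.Sum +-*-semiring
  using (∑-distrib-+; ∑-comm; sum-cong-≗; sum-replicate-zero; *-distribˡ-sum; *-distribʳ-sum)
  renaming (sum to ∑)

open +-*-Solver using (solve; _:+_; _:*_; _:=_; con)

∑-mono-≤ : ∀ {n} {f g : Fin n → ℕ} → (∀ i → f i ≤ g i) → ∑ f ≤ ∑ g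
∑-mono-≤ {zero}  f≤g = z≤n
∑-mono-≤ {suc n} f≤g = +-mono-≤ (f≤g zero) (∑-mono-≤ (f≤g ∘ suc))

∑-const : ∀ {n} c → ∑ {n} (λ _ → c) ≡ n * c
∑-const {zero}  c = refl
∑-const {suc n} c = cong (c +_) (∑-const {n} c)

∑-*-∑ : ∀ {m n} (f : Fin m → ℕ) (g : Fin n → ℕ) →
  ∑ f * ∑ g ≡ ∑ (λ i → ∑ (λ j → f i * g j))
∑-*-∑ f g = trans (*-distribʳ-sum (∑ g) f) (sum-cong-≗ (λ i → *-distribˡ-sum (f i) g))

∑-comm₃ : ∀ {l m n} (H : Fin l → Fin m → Fin n → ℕ) →
  ∑ (λ x → ∑ (λ a → ∑ (λ b → H x a b))) ≡ ∑ (λ a → ∑ (λ b → ∑ (λ x → H x a b)))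
∑-comm₃ H = trans (∑-comm (λ x a → ∑ (H x a))) (sum-cong-≗ (λ a → ∑-comm (λ x b → H x a b)))

∑∑ : ∀ {n} → (Fin n → Fin n → ℕ) → ℕ
∑∑ F = ∑ (λ a → ∑ (F a))

-- Sum over all quadruples of indices, taken in the order a, c, b, d so that
-- the square of a double sum over (a,b) is a fourfold sum (see ∑∑-square).
∑₄ : ∀ {n} → (Fin n → Fin n → Fin n → Fin n → ℕ) → ℕ
∑₄ F = ∑ (λ a → ∑ (λ c → ∑ (λ b → ∑ (λ d → F a b c d))))

∑₄-cong : ∀ {n} {F F′ : Fin n → Fin n → Fin n → Fin n → ℕ} →
  (∀ a b c d → F a b c d ≡ F′ a b c d) → ∑₄ F ≡ ∑₄ F′
∑₄-cong F≡F′ = sum-cong-≗ (λ a → sum-cong-≗ (λ c → sum-cong-≗ (λ b → sum-cong-≗ (F≡F′ a b c))))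

∑₄-swap : ∀ {n} (F : Fin n → Fin n → Fin n → Fin n → ℕ) → ∑₄ F ≡ ∑₄ (λ a b c d → F a d c b)
∑₄-swap F = sum-cong-≗ (λ a → sum-cong-≗ (λ c → ∑-comm (λ b d → F a b c d)))

∑∑-square : ∀ {n} (F : Fin n → Fin n → ℕ) → ∑∑ F * ∑∑ F ≡ ∑₄ (λ a b c d → F a b * F c d)
∑∑-square F = trans (∑-*-∑ (λ a → ∑ (F a)) (λ c → ∑ (F c)))
  (sum-cong-≗ (λ a → sum-cong-≗ (λ c → ∑-*-∑ (F a) (F c))))

∑-∑∑-square : ∀ {n} (F : Fin n → Fin n → Fin n → ℕ) →
  ∑ (λ x → ∑∑ (F x) * ∑∑ (F x)) ≡ ∑₄ (λ a b c d → ∑ (λ x → F x a b * F x c d))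
∑-∑∑-square F = begin
  ∑ (λ x → ∑∑ (F x) * ∑∑ (F x))
    ≡⟨ sum-cong-≗ (λ x → ∑∑-square (F x)) ⟩
  ∑ (λ x → ∑₄ (λ a b c d → F x a b * F x c d))
    ≡⟨ ∑-comm₃ (λ x a c → ∑ (λ b → ∑ (λ d → F x a b * F x c d))) ⟩
  ∑ (λ a → ∑ (λ c → ∑ (λ x → ∑ (λ b → ∑ (λ d → F x a b * F x c d)))))
    ≡⟨ sum-cong-≗ (λ a → sum-cong-≗ (λ c → ∑-comm₃ (λ x b d → F x a b * F x c d))) ⟩
  ∑₄ (λ a b c d → ∑ (λ x → F x a b * F x c d)) ∎
  where open ≡-Reasoning

𝟙 : Bool → ℕ
𝟙 true  = 1
𝟙 false = 0

𝟙-∧ : ∀ a b → 𝟙 (a ∧ b) ≡ 𝟙 a * 𝟙 b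
𝟙-∧ true  b = sym (+-identityʳ (𝟙 b))
𝟙-∧ false b = refl

𝟙-idem : ∀ b → 𝟙 b * 𝟙 b ≡ 𝟙 b
𝟙-idem true  = refl
𝟙-idem false = refl

-- Defs.r tests decisions with ⌊_⌋; δ and χ use does.
𝟙⌊⌋ : ∀ {P : Set} (d : Dec P) → 𝟙 ⌊ d ⌋ ≡ 𝟙 (does d)
𝟙⌊⌋ (true  because _) = refl
𝟙⌊⌋ (false because _) = refl

δ : ∀ {n} → Fin n → Fin n → ℕ
δ a b = 𝟙 (does (a ≟ᶠ b))

χ : ∀ {n} → Subset n → Fin n → ℕ
χ A a = 𝟙 (does (a ∈? A))

∣∣≡∑χ : ∀ {n} (A : Subset n) → ∣ A ∣ ≡ ∑ (χ A)
∣∣≡∑χ []            = refl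
∣∣≡∑χ (inside  ∷ A) = cong suc (∣∣≡∑χ A)
∣∣≡∑χ (outside ∷ A) = ∣∣≡∑χ A

δ-cong : ∀ {n} {a b c d : Fin n} → (a ≡ b → c ≡ d) → (c ≡ d → a ≡ b) → δ a b ≡ δ c d
δ-cong {a = a} {b} {c} {d} to from with a ≟ᶠ b | c ≟ᶠ d
... | yes _   | yes _   = refl
... | no _    | no _    = refl
... | yes a≡b | no c≢d  = ⊥-elim (c≢d (to a≡b))
... | no a≢b  | yes c≡d = ⊥-elim (a≢b (from c≡d))

δ-sym : ∀ {n} (a b : Fin n) → δ a b ≡ δ b a
δ-sym a b = δ-cong {a = a} {b} {b} {a} sym sym

∑-δ : ∀ {n} (c : Fin n) (f : Fin n → ℕ) → ∑ (λ e → δ c e * f e) ≡ f c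
∑-δ {suc n} zero    f = trans (cong (1 * f zero +_) (sum-replicate-zero n))
                              (trans (+-identityʳ _) (*-identityˡ (f zero)))
∑-δ {suc n} (suc c) f = ∑-δ c (f ∘ suc)

∑δ≡1 : ∀ {n} (c : Fin n) → ∑ (δ c) ≡ 1
∑δ≡1 c = trans (sum-cong-≗ (λ e → sym (*-identityʳ (δ c e)))) (∑-δ c (λ _ → 1))

∑-w*δ : ∀ {n} (w : ℕ) (c : Fin n) → ∑ (λ e → w * δ c e) ≡ w
∑-w*δ w c = begin
  ∑ (λ e → w * δ c e)    ≡⟨ *-distribˡ-sum w (δ c) ⟨
  w * ∑ (δ c)            ≡⟨ cong (w *_) (∑δ≡1 c) ⟩
  w * 1                  ≡⟨ *-identityʳ w ⟩
  w                      ∎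
  where open ≡-Reasoning

erase : ∀ {n} → Fin n → (Fin n → ℕ) → Fin n → ℕ
erase c f e = if does (c ≟ᶠ e) then 0 else f e

erase-split : ∀ {n} (c : Fin n) (f : Fin n → ℕ) e → f e ≡ δ c e * f e + erase c f e
erase-split c f e with c ≟ᶠ e
... | yes _ = sym (trans (+-identityʳ _) (+-identityʳ (f e)))
... | no _  = refl

∑-erase : ∀ {n} (c : Fin n) (f : Fin n → ℕ) → ∑ f ≡ f c + ∑ (erase c f)
∑-erase c f = begin
  ∑ f                                      ≡⟨ sum-cong-≗ (erase-split c f) ⟩
  ∑ (λ e → δ c e * f e + erase c f e)      ≡⟨ ∑-distrib-+ (λ e → δ c e * f e) (erase c f) ⟩
  ∑ (λ e → δ c e * f e) + ∑ (erase c f)    ≡⟨ cong (_+ ∑ (erase c f)) (∑-δ c f) ⟩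
  f c + ∑ (erase c f)                      ∎
  where open ≡-Reasoning

erase-square : ∀ {n} (c : Fin n) (f : Fin n → ℕ) e →
  erase c f e * erase c f e ≡ erase c (λ e → f e * f e) e
erase-square c f e with c ≟ᶠ e
... | yes _ = refl
... | no _  = refl

2xy≤x²+y²-gap : ∀ x d → 2 * (x * (x + d)) ≤ x * x + (x + d) * (x + d)
2xy≤x²+y²-gap x d = subst (2 * (x * (x + d)) ≤_)
  (solve 2 (λ x d → con 2 :* (x :* (x :+ d)) :+ d :* d := x :* x :+ (x :+ d) :* (x :+ d)) refl x d)
  (m≤m+n (2 * (x * (x + d))) (d * d))

2xy≤x²+y² : ∀ x y → 2 * (x * y) ≤ x * x + y * y
2xy≤x²+y² x y with ≤-total x y
... | inj₁ x≤y with d , refl ← m≤n⇒∃[o]m+o≡n x≤y = 2xy≤x²+y²-gap x d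
... | inj₂ y≤x with d , refl ← m≤n⇒∃[o]m+o≡n y≤x =
  subst₂ _≤_ (cong (2 *_) (*-comm y (y + d))) (+-comm (y * y) _) (2xy≤x²+y²-gap y d)

-- Cauchy–Schwarz: (Σ f)² ≤ n·Σ f², from Σᵢ Σⱼ 2fᵢfⱼ ≤ Σᵢ Σⱼ (fᵢ² + fⱼ²).
cauchy-schwarz : ∀ {n} (f : Fin n → ℕ) → ∑ f * ∑ f ≤ n * ∑ (λ i → f i * f i)
cauchy-schwarz {n} f = *-cancelˡ-≤ 2 (begin
  2 * (∑ f * ∑ f)                                       ≡⟨ cong (2 *_) (∑-*-∑ f f) ⟩
  2 * ∑ (λ i → ∑ (λ j → f i * f j))                     ≡⟨ *-distribˡ-sum 2 (λ i → ∑ (λ j → f i * f j)) ⟩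
  ∑ (λ i → 2 * ∑ (λ j → f i * f j))                     ≡⟨ sum-cong-≗ (λ i → *-distribˡ-sum 2 (λ j → f i * f j)) ⟩
  ∑ (λ i → ∑ (λ j → 2 * (f i * f j)))                   ≤⟨ ∑-mono-≤ (λ i → ∑-mono-≤ (λ j → 2xy≤x²+y² (f i) (f j))) ⟩
  ∑ (λ i → ∑ (λ j → f i * f i + f j * f j))             ≡⟨ sum-cong-≗ (λ i → ∑-distrib-+ (λ _ → f i * f i) sq) ⟩
  ∑ (λ i → ∑ {n} (λ _ → f i * f i) + Q)                 ≡⟨ sum-cong-≗ (λ i → cong (_+ Q) (∑-const {n} (f i * f i))) ⟩
  ∑ (λ i → n * (f i * f i) + Q)                         ≡⟨ ∑-distrib-+ (λ i → n * sq i) (λ _ → Q) ⟩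
  ∑ (λ i → n * sq i) + ∑ {n} (λ _ → Q)                  ≡⟨ cong₂ _+_ (*-distribˡ-sum n sq) (sym (∑-const {n} Q)) ⟨
  n * Q + n * Q                                         ≡⟨ cong (n * Q +_) (+-identityʳ (n * Q)) ⟨
  2 * (n * Q)                                           ∎)
  where
  open ≤-Reasoning
  sq : Fin _ → ℕ
  sq i = f i * f i
  Q : ℕ
  Q = ∑ sq

below : ∀ {n} → (Fin n → Fin n → ℕ) → ℕ
below {zero}  F = 0
below {suc n} F = ∑ (λ j → F zero (suc j)) + below (λ i j → F (suc i) (suc j))

∑∑-symmetric : ∀ {n} (F : Fin n → Fin n → ℕ) → (∀ i j → F i j ≡ F j i) →
  ∑∑ F ≡ ∑ (λ i → F i i) + 2 * below F
∑∑-symmetric {zero}  F F-sym = refl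
∑∑-symmetric {suc n} F F-sym = begin
  (F₀₀ + R) + ∑ (λ i → F (suc i) zero + ∑ (F′ i))
    ≡⟨ cong ((F₀₀ + R) +_) (∑-distrib-+ (λ i → F (suc i) zero) (λ i → ∑ (F′ i))) ⟩
  (F₀₀ + R) + (∑ (λ i → F (suc i) zero) + ∑∑ F′)
    ≡⟨ cong (λ C → (F₀₀ + R) + (C + ∑∑ F′)) (sum-cong-≗ (λ i → F-sym (suc i) zero)) ⟩
  (F₀₀ + R) + (R + ∑∑ F′)
    ≡⟨ cong (λ z → (F₀₀ + R) + (R + z)) (∑∑-symmetric F′ (λ i j → F-sym (suc i) (suc j))) ⟩
  (F₀₀ + R) + (R + (∑ (λ i → F′ i i) + 2 * below F′))
    ≡⟨ solve 4 (λ a r d l → (a :+ r) :+ (r :+ (d :+ con 2 :* l)) := (a :+ d) :+ con 2 :* (r :+ l))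
         refl F₀₀ R (∑ (λ i → F′ i i)) (below F′) ⟩
  (F₀₀ + ∑ (λ i → F′ i i)) + 2 * (R + below F′) ∎
  where
  open ≡-Reasoning
  F₀₀ : ℕ
  F₀₀ = F zero zero
  R : ℕ
  R = ∑ (λ j → F zero (suc j))
  F′ : Fin n → Fin n → ℕ
  F′ i j = F (suc i) (suc j)

length-filterᵇ : ∀ {X : Set} (p : X → Bool) (xs : List X) →
  length (filterᵇ p xs) ≡ listSum (map (𝟙 ∘ p) xs)
length-filterᵇ p []       = refl
length-filterᵇ p (x ∷ xs) with p x
... | true  = cong suc (length-filterᵇ p xs)
... | false = length-filterᵇ p xs

listSum-cartesianProduct : ∀ {X Y : Set} (f : X × Y → ℕ) (xs : List X) (ys : List Y) →
  listSum (map f (cartesianProduct xs ys)) ≡ listSum (map (λ x → listSum (map (λ y → f (x , y)) ys)) xs)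
listSum-cartesianProduct f []       ys = refl
listSum-cartesianProduct f (x ∷ xs) ys = begin
  listSum (map f (map (x ,_) ys ++ cartesianProduct xs ys))
    ≡⟨ cong listSum (map-++ f (map (x ,_) ys) (cartesianProduct xs ys)) ⟩
  listSum (map f (map (x ,_) ys) ++ map f (cartesianProduct xs ys))
    ≡⟨ listSum-++ (map f (map (x ,_) ys)) _ ⟩
  listSum (map f (map (x ,_) ys)) + listSum (map f (cartesianProduct xs ys))
    ≡⟨ cong₂ _+_ (cong listSum (sym (map-∘ ys))) (listSum-cartesianProduct f xs ys) ⟩
  listSum (map (λ y → f (x , y)) ys) + listSum (map (λ x → listSum (map (λ y → f (x , y)) ys)) xs) ∎
  where open ≡-Reasoning

listSum-tabulate : ∀ {n} (f : Fin n → ℕ) → listSum (tabulate f) ≡ ∑ f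
listSum-tabulate {zero}  f = refl
listSum-tabulate {suc n} f = cong (f zero +_) (listSum-tabulate (f ∘ suc))

listSum-allFin : ∀ {n} (f : Fin n → ℕ) → listSum (map f (allFin n)) ≡ ∑ f
listSum-allFin f = trans (cong listSum (map-tabulate id f)) (listSum-tabulate f)

mass-off-diagonal : ∀ m S → suc m + S ≡ suc m * suc m → S ≡ suc m * m
mass-off-diagonal m S e = +-cancelˡ-≡ (suc m) S (suc m * m) (trans e (*-suc (suc m) m))

even-arith : ∀ {k S T q} g′ → k + S ≡ k * k → S * S ≤ q * T → T ≤ g′ * (k * k) →
  (k ∸ 1) ^ 2 ≤ g′ * q
even-arith {zero}            g′ _   _  _  = z≤n
even-arith {suc m} {S} {T} {q} g′ k+S S²≤qT T≤ =
  subst (_≤ g′ * q) (cong (m *_) (sym (*-identityʳ m))) (*-cancelʳ-≤ (m * m) (g′ * q) (k * k) (begin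
    m * m * (k * k)    ≡⟨ solve 2 (λ m k → m :* m :* (k :* k) := (k :* m) :* (k :* m)) refl m k ⟩
    (k * m) * (k * m)  ≡⟨ cong (λ z → z * z) (mass-off-diagonal m S k+S) ⟨
    S * S              ≤⟨ S²≤qT ⟩
    q * T              ≤⟨ *-monoʳ-≤ q T≤ ⟩
    q * (g′ * (k * k)) ≡⟨ *-assoc q g′ (k * k) ⟨
    q * g′ * (k * k)   ≡⟨ cong (_* (k * k)) (*-comm q g′) ⟩
    g′ * q * (k * k)   ∎))
  where
  open ≤-Reasoning
  k : ℕ
  k = suc m

odd-core : ∀ u h m → u + (2 + h) ≡ 2 * h * m →
  u * u * ((2 + h) + h * suc m) ≤ 4 * h * h * h * (suc m * m * m)
odd-core u h m e = begin
  u * u * ((2 + h) + P)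
    ≡⟨ solve 3 (λ u h P → u :* u :* ((con 2 :+ h) :+ P) := u :* u :* P :+ (con 2 :+ h) :* (u :* u)) refl u h P ⟩
  u * u * P + (2 + h) * (u * u)
    ≤⟨ +-monoʳ-≤ (u * u * P) (*-monoʳ-≤ (2 + h) u²≤) ⟩
  u * u * P + (2 + h) * (P * (2 * u + (2 + h)))
    ≡⟨ solve 3 (λ u c P → u :* u :* P :+ c :* (P :* (con 2 :* u :+ c)) := P :* ((u :+ c) :* (u :+ c))) refl u (2 + h) P ⟩
  P * ((u + (2 + h)) * (u + (2 + h)))
    ≡⟨ cong (λ z → P * (z * z)) e ⟩
  P * ((2 * h * m) * (2 * h * m))
    ≡⟨ solve 2 (λ h m → (h :* (con 1 :+ m)) :* ((con 2 :* h :* m) :* (con 2 :* h :* m))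
                       := con 4 :* h :* h :* h :* ((con 1 :+ m) :* m :* m)) refl h m ⟩
  4 * h * h * h * (suc m * m * m) ∎
  where
  open ≤-Reasoning
  P : ℕ
  P = h * suc m
  u²≤ : u * u ≤ P * (2 * u + (2 + h))
  u²≤ = begin
    u * u                                            ≤⟨ *-monoʳ-≤ u (subst (u ≤_) e (m≤m+n u (2 + h))) ⟩
    u * (2 * h * m)                                  ≤⟨ m≤m+n _ (2 * u * h + P * (2 + h)) ⟩
    u * (2 * h * m) + (2 * u * h + P * (2 + h))
      ≡⟨ solve 3 (λ u h m → u :* (con 2 :* h :* m) :+ (con 2 :* u :* h :+ (h :* (con 1 :+ m)) :* (con 2 :+ h))
                          := (h :* (con 1 :+ m)) :* (con 2 :* u :+ (con 2 :+ h))) refl u h m ⟩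
    P * (2 * u + (2 + h))                            ∎

-- The odd-case conclusion, with h = g − 2: from S = k(k−1), S² ≤ qT and
-- T ≤ hk² + (2+h)k, get (2hk − (3h+2))² ≤ 4h³q.
odd-arith : ∀ {k S T q} h → k + S ≡ k * k → S * S ≤ q * T → T ≤ h * (k * k) + (2 + h) * k →
  (2 * h * k ∸ (2 + 3 * h)) ^ 2 ≤ 2 * h * (2 * h) * h * q
odd-arith {zero} h _ _ _ rewrite *-zeroʳ (2 * h) = z≤n
odd-arith {suc m} {S} {T} {q} h k+S S²≤qT T≤ with 2 * h * suc m ≤? 2 + 3 * h
... | yes small = subst (_≤ 2 * h * (2 * h) * h * q) (sym (cong (_^ 2) (m≤n⇒m∸n≡0 small))) z≤n
... | no large = subst₂ _≤_ (cong (u *_) (sym (*-identityʳ u))) 4h³≡[2h]²h u²≤4h³q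
  where
  open ≤-Reasoning
  k M u : ℕ
  k = suc m
  M = (2 + h) + h * k
  u = 2 * h * k ∸ (2 + 3 * h)
  4h³≡[2h]²h : 4 * h * h * h * q ≡ 2 * h * (2 * h) * h * q
  4h³≡[2h]²h = solve 2 (λ h q → con 4 :* h :* h :* h :* q := con 2 :* h :* (con 2 :* h) :* h :* q) refl h q
  u+2+h≡2hm : u + (2 + h) ≡ 2 * h * m
  u+2+h≡2hm = +-cancelˡ-≡ (2 * h) _ _ (begin-equality
    2 * h + (u + (2 + h))     ≡⟨ solve 2 (λ h u → con 2 :* h :+ (u :+ (con 2 :+ h)) := u :+ (con 2 :+ con 3 :* h)) refl h u ⟩
    u + (2 + 3 * h)           ≡⟨ m∸n+n≡m (<⇒≤ (≰⇒> large)) ⟩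
    2 * h * k                 ≡⟨ *-suc (2 * h) m ⟩
    2 * h + 2 * h * m         ∎)
  km²≤qM : k * m * m ≤ q * M
  km²≤qM = *-cancelˡ-≤ k (begin
    k * (k * m * m)           ≡⟨ solve 2 (λ k m → k :* (k :* m :* m) := (k :* m) :* (k :* m)) refl k m ⟩
    (k * m) * (k * m)         ≡⟨ cong (λ z → z * z) (mass-off-diagonal m S k+S) ⟨
    S * S                     ≤⟨ S²≤qT ⟩
    q * T                     ≤⟨ *-monoʳ-≤ q T≤ ⟩
    q * (h * (k * k) + (2 + h) * k)
      ≡⟨ solve 3 (λ q h k → q :* (h :* (k :* k) :+ (con 2 :+ h) :* k) := k :* (q :* ((con 2 :+ h) :+ h :* k))) refl q h k ⟩
    k * (q * M)               ∎)
  u²≤4h³q : u * u ≤ 4 * h * h * h * q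
  u²≤4h³q = *-cancelʳ-≤ (u * u) (4 * h * h * h * q) M (begin
    u * u * M                       ≤⟨ odd-core u h m u+2+h≡2hm ⟩
    4 * h * h * h * (k * m * m)     ≤⟨ *-monoʳ-≤ (4 * h * h * h) km²≤qM ⟩
    4 * h * h * h * (q * M)         ≡⟨ *-assoc (4 * h * h * h) q M ⟨
    4 * h * h * h * q * M           ∎)

-- Pointwise Sidon bound for odd g: if r ≤ g and r ≡ d (mod 2), then
-- r² ≤ (g−1)r + gd  (r = g is impossible when d = 0).
odd-pointwise : ∀ g r d l → r ≤ g → r ≡ d + 2 * l → ¬ 2 ∣ g → r * r ≤ (g ∸ 1) * r + g * d
odd-pointwise g r zero l r≤g r≡2l g-odd with r ≟ g
... | yes refl = ⊥-elim (g-odd (divides l (trans r≡2l (*-comm 2 l))))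
... | no r≢g   = ≤-trans (*-monoˡ-≤ r (pred-mono-≤ (≤∧≢⇒< r≤g r≢g))) (m≤m+n ((g ∸ 1) * r) (g * 0))
odd-pointwise zero    zero    (suc d) l r≤g _ _ = z≤n
odd-pointwise (suc g′) r (suc d) l r≤g _ _ = begin
  r * r                    ≤⟨ *-monoˡ-≤ r r≤g ⟩
  suc g′ * r               ≡⟨ +-comm r (g′ * r) ⟩
  g′ * r + r               ≤⟨ +-monoʳ-≤ (g′ * r) (≤-trans r≤g (m≤m*n (suc g′) (suc d))) ⟩
  g′ * r + suc g′ * suc d  ∎
  where open ≤-Reasoning

3[2+h]∸4≡2+3h : ∀ h → 3 * (2 + h) ∸ 4 ≡ 2 + 3 * h
3[2+h]∸4≡2+3h h = trans (cong (_∸ 4) (solve 1 (λ h → con 3 :* (con 2 :+ h) := con 4 :+ (con 2 :+ con 3 :* h)) refl h))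
                        (m+n∸m≡n 4 (2 + 3 * h))

module Energy {q : ℕ} (G : FiniteAbelianGroup q) (A : Subset q) where

  open FiniteAbelianGroup G
  open IsAbelianGroup isAbelianGroup using (assoc; comm; identityˡ; isGroup)

  group : Group 0ℓ 0ℓ
  group = record { isGroup = isGroup }

  open import Algebra.Properties.Group group using (//-rightDividesˡ; //-rightDividesʳ)

  x≡y/z⇒x∙z≡y : ∀ {x y z} → x ≡ y ∙ (z ⁻¹) → x ∙ z ≡ y
  x≡y/z⇒x∙z≡y {y = y} {z} refl = //-rightDividesˡ z y

  x∙z≡y⇒x≡y/z : ∀ {x y z} → x ∙ z ≡ y → x ≡ y ∙ (z ⁻¹)
  x∙z≡y⇒x≡y/z {x} {z = z} refl = sym (//-rightDividesʳ z x)

  δ-dif : ∀ a e b → δ a (e ∙ b) ≡ δ (a ∙ (b ⁻¹)) e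
  δ-dif a e b = δ-cong (λ a≡eb → sym (x∙z≡y⇒x≡y/z (sym a≡eb)))
                       (λ a/b≡e → sym (x≡y/z⇒x∙z≡y (sym a/b≡e)))

  δ-quadruple : ∀ a b c d → δ c ((a ∙ (b ⁻¹)) ∙ d) ≡ δ (a ∙ d) (c ∙ b)
  δ-quadruple a b c d = δ-cong (λ c≡ → sym (x≡y/z⇒x∙z≡y (trans c≡ regroup)))
                               (λ ad≡cb → trans (x∙z≡y⇒x≡y/z (sym ad≡cb)) (sym regroup))
    where
    regroup : (a ∙ (b ⁻¹)) ∙ d ≡ (a ∙ d) ∙ (b ⁻¹)
    regroup = trans (assoc a (b ⁻¹) d) (trans (cong (a ∙_) (comm (b ⁻¹) d)) (sym (assoc a d (b ⁻¹))))

  X : Fin q → ℕ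
  X = χ A

  k : ℕ
  k = ∑ X

  ∑-pairs : (P : Fin q → Fin q → Fin q → ℕ) → (∀ a b → ∑ (λ x → P x a b) ≡ 1) →
    ∑ (λ x → ∑∑ (λ a b → X a * X b * P x a b)) ≡ k * k
  ∑-pairs P once = begin
    ∑ (λ x → ∑∑ (λ a b → X a * X b * P x a b))       ≡⟨ ∑-comm₃ (λ x a b → X a * X b * P x a b) ⟩
    ∑∑ (λ a b → ∑ (λ x → X a * X b * P x a b))       ≡⟨ sum-cong-≗ (λ a → sum-cong-≗ (λ b → counted-once a b)) ⟩
    ∑∑ (λ a b → X a * X b)                           ≡⟨ ∑-*-∑ X X ⟨
    k * k                                            ∎
    where
    open ≡-Reasoning
    counted-once : ∀ a b → ∑ (λ x → X a * X b * P x a b) ≡ X a * X b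
    counted-once a b = trans (sym (*-distribˡ-sum (X a * X b) (λ x → P x a b)))
                             (trans (cong (X a * X b *_) (once a b)) (*-identityʳ (X a * X b)))

  ∑-pairs-square : (P : Fin q → Fin q → Fin q → ℕ) →
    ∑ (λ x → ∑∑ (λ a b → X a * X b * P x a b) * ∑∑ (λ a b → X a * X b * P x a b))
      ≡ ∑₄ (λ a b c d → (X a * X b) * (X c * X d) * ∑ (λ x → P x a b * P x c d))
  ∑-pairs-square P = trans (∑-∑∑-square (λ x a b → X a * X b * P x a b)) (∑₄-cong (λ a b c d → begin
    ∑ (λ x → X a * X b * P x a b * (X c * X d * P x c d))
      ≡⟨ sum-cong-≗ (λ x → [m*n]*[o*p]≡[m*o]*[n*p] (X a * X b) (P x a b) (X c * X d) (P x c d)) ⟩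
    ∑ (λ x → (X a * X b) * (X c * X d) * (P x a b * P x c d))
      ≡⟨ *-distribˡ-sum ((X a * X b) * (X c * X d)) (λ x → P x a b * P x c d) ⟨
    (X a * X b) * (X c * X d) * ∑ (λ x → P x a b * P x c d) ∎))
    where open ≡-Reasoning

  repr : Fin q → Fin q → Fin q → ℕ
  repr x a b = X a * X b * δ (a ∙ b) x

  rep : Fin q → ℕ
  rep x = ∑∑ (repr x)

  dif : Fin q → ℕ
  dif e = ∑∑ (λ a b → X a * X b * δ a (e ∙ b))

  sq : Fin q → ℕ
  sq x = ∑ (λ a → X a * δ (a ∙ a) x)

  r≡rep : ∀ x → r G A x ≡ rep x
  r≡rep x = begin
    r G A x
      ≡⟨ length-filterᵇ ok (cartesianProduct (allFin q) (allFin q)) ⟩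
    listSum (map (𝟙 ∘ ok) (cartesianProduct (allFin q) (allFin q)))
      ≡⟨ listSum-cartesianProduct (𝟙 ∘ ok) (allFin q) (allFin q) ⟩
    listSum (map (λ a → listSum (map (λ b → 𝟙 (ok (a , b))) (allFin q))) (allFin q))
      ≡⟨ listSum-allFin (λ a → listSum (map (λ b → 𝟙 (ok (a , b))) (allFin q))) ⟩
    ∑ (λ a → listSum (map (λ b → 𝟙 (ok (a , b))) (allFin q)))
      ≡⟨ sum-cong-≗ (λ a → listSum-allFin (λ b → 𝟙 (ok (a , b)))) ⟩
    ∑∑ (λ a b → 𝟙 (ok (a , b)))
      ≡⟨ sum-cong-≗ (λ a → sum-cong-≗ (λ b → indicator a b)) ⟩
    rep x ∎
    where
    open ≡-Reasoning
    ok : Fin q × Fin q → Bool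
    ok (a , b) = ⌊ a ∈? A ⌋ ∧ ⌊ b ∈? A ⌋ ∧ ⌊ (a ∙ b) ≟ᶠ x ⌋
    indicator : ∀ a b → 𝟙 (ok (a , b)) ≡ X a * X b * δ (a ∙ b) x
    indicator a b = begin
      𝟙 (⌊ a ∈? A ⌋ ∧ ⌊ b ∈? A ⌋ ∧ ⌊ (a ∙ b) ≟ᶠ x ⌋)
        ≡⟨ 𝟙-∧ ⌊ a ∈? A ⌋ _ ⟩
      𝟙 ⌊ a ∈? A ⌋ * 𝟙 (⌊ b ∈? A ⌋ ∧ ⌊ (a ∙ b) ≟ᶠ x ⌋)
        ≡⟨ cong (𝟙 ⌊ a ∈? A ⌋ *_) (𝟙-∧ ⌊ b ∈? A ⌋ _) ⟩
      𝟙 ⌊ a ∈? A ⌋ * (𝟙 ⌊ b ∈? A ⌋ * 𝟙 ⌊ (a ∙ b) ≟ᶠ x ⌋)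
        ≡⟨ cong₂ _*_ (𝟙⌊⌋ (a ∈? A)) (cong₂ _*_ (𝟙⌊⌋ (b ∈? A)) (𝟙⌊⌋ ((a ∙ b) ≟ᶠ x))) ⟩
      X a * (X b * δ (a ∙ b) x)
        ≡⟨ *-assoc (X a) (X b) _ ⟨
      X a * X b * δ (a ∙ b) x ∎

  ∑rep : ∑ rep ≡ k * k
  ∑rep = ∑-pairs (λ x a b → δ (a ∙ b) x) (λ a b → ∑δ≡1 (a ∙ b))

  ∑dif : ∑ dif ≡ k * k
  ∑dif = ∑-pairs (λ e a b → δ a (e ∙ b)) once
    where
    once : ∀ a b → ∑ (λ e → δ a (e ∙ b)) ≡ 1
    once a b = trans (sum-cong-≗ (λ e → δ-dif a e b)) (∑δ≡1 (a ∙ (b ⁻¹)))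

  dif-ε : dif ε ≡ k
  dif-ε = sum-cong-≗ (λ a → begin
    ∑ (λ b → X a * X b * δ a (ε ∙ b))   ≡⟨ sum-cong-≗ (λ b → cong (λ z → X a * X b * δ a z) (identityˡ b)) ⟩
    ∑ (λ b → X a * X b * δ a b)         ≡⟨ sum-cong-≗ (λ b → *-assoc (X a) (X b) (δ a b)) ⟩
    ∑ (λ b → X a * (X b * δ a b))       ≡⟨ *-distribˡ-sum (X a) (λ b → X b * δ a b) ⟨
    X a * ∑ (λ b → X b * δ a b)         ≡⟨ cong (X a *_) (trans (sum-cong-≗ (λ b → *-comm (X b) (δ a b))) (∑-δ a X)) ⟩
    X a * X a                           ≡⟨ 𝟙-idem (does (a ∈? A)) ⟩
    X a                                 ∎)
    where open ≡-Reasoning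

  -- Σ r² = Σ s²: both count the quadruples in A⁴ with a·b = c·d.
  energy : ∑ (λ x → rep x * rep x) ≡ ∑ (λ e → dif e * dif e)
  energy = begin
    ∑ (λ x → rep x * rep x)
      ≡⟨ ∑-pairs-square (λ x a b → δ (a ∙ b) x) ⟩
    ∑₄ (λ a b c d → W a b c d * ∑ (λ x → δ (a ∙ b) x * δ (c ∙ d) x))
      ≡⟨ ∑₄-cong (λ a b c d → cong (W a b c d *_) (∑-δ (a ∙ b) (δ (c ∙ d)))) ⟩
    ∑₄ (λ a b c d → W a b c d * δ (c ∙ d) (a ∙ b))
      ≡⟨ ∑₄-swap (λ a b c d → W a b c d * δ (c ∙ d) (a ∙ b)) ⟩
    ∑₄ (λ a b c d → W a d c b * δ (c ∙ b) (a ∙ d))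
      ≡⟨ ∑₄-cong (λ a b c d → cong₂ _*_ (W-swap a b c d) (δ-sym (c ∙ b) (a ∙ d))) ⟩
    ∑₄ (λ a b c d → W a b c d * δ (a ∙ d) (c ∙ b))
      ≡⟨ ∑₄-cong (λ a b c d → cong (W a b c d *_) (difference-quadruple a b c d)) ⟨
    ∑₄ (λ a b c d → W a b c d * ∑ (λ e → δ a (e ∙ b) * δ c (e ∙ d)))
      ≡⟨ ∑-pairs-square (λ e a b → δ a (e ∙ b)) ⟨
    ∑ (λ e → dif e * dif e) ∎
    where
    open ≡-Reasoning
    W : Fin q → Fin q → Fin q → Fin q → ℕ
    W a b c d = (X a * X b) * (X c * X d)
    W-swap : ∀ a b c d → W a d c b ≡ W a b c d
    W-swap a b c d = solve 4 (λ a b c d → (a :* d) :* (c :* b) := (a :* b) :* (c :* d)) refl (X a) (X b) (X c) (X d)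
    difference-quadruple : ∀ a b c d → ∑ (λ e → δ a (e ∙ b) * δ c (e ∙ d)) ≡ δ (a ∙ d) (c ∙ b)
    difference-quadruple a b c d = begin
      ∑ (λ e → δ a (e ∙ b) * δ c (e ∙ d))                ≡⟨ sum-cong-≗ (λ e → cong (_* δ c (e ∙ d)) (δ-dif a e b)) ⟩
      ∑ (λ e → δ (a ∙ (b ⁻¹)) e * δ c (e ∙ d))           ≡⟨ ∑-δ (a ∙ (b ⁻¹)) (λ e → δ c (e ∙ d)) ⟩
      δ c ((a ∙ (b ⁻¹)) ∙ d)                             ≡⟨ δ-quadruple a b c d ⟩
      δ (a ∙ d) (c ∙ b)                                  ∎

  ∑sq : ∑ sq ≡ k
  ∑sq = trans (∑-comm (λ x a → X a * δ (a ∙ a) x)) (sum-cong-≗ (λ a → ∑-w*δ (X a) (a ∙ a)))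

  -- r(x) ≡ d(x) (mod 2): off-diagonal representations come in pairs (a,b), (b,a).
  rep-parity : ∀ x → rep x ≡ sq x + 2 * below (repr x)
  rep-parity x = trans (∑∑-symmetric (repr x) repr-sym) (cong (_+ 2 * below (repr x)) (sum-cong-≗ diagonal))
    where
    repr-sym : ∀ a b → repr x a b ≡ repr x b a
    repr-sym a b = cong₂ _*_ (*-comm (X a) (X b)) (cong (λ z → δ z x) (comm a b))
    diagonal : ∀ a → repr x a a ≡ X a * δ (a ∙ a) x
    diagonal a = cong (_* δ (a ∙ a) x) (𝟙-idem (does (a ∈? A)))

  E S T : ℕ
  E = ∑ (λ x → rep x * rep x)
  S = ∑ (erase ε dif)
  T = ∑ (erase ε (λ e → dif e * dif e))

  k+S≡k² : k + S ≡ k * k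
  k+S≡k² = trans (cong (_+ S) (sym dif-ε)) (trans (sym (∑-erase ε dif)) ∑dif)

  k²+T≡E : k * k + T ≡ E
  k²+T≡E = trans (cong (λ z → z * z + T) (sym dif-ε)) (trans (sym (∑-erase ε (λ e → dif e * dif e))) (sym energy))

  S²≤qT : S * S ≤ q * T
  S²≤qT = subst (λ z → S * S ≤ q * z) (sum-cong-≗ (erase-square ε dif)) (cauchy-schwarz (erase ε dif))

  module _ {g : ℕ} (sidon : IsSidon G g A) where

    rep≤g : ∀ x → rep x ≤ g
    rep≤g x = subst (_≤ g) (r≡rep x) (sidon x)

    energy-bound : E ≤ g * (k * k)
    energy-bound = begin
      E                     ≤⟨ ∑-mono-≤ (λ x → *-monoˡ-≤ (rep x) (rep≤g x)) ⟩
      ∑ (λ x → g * rep x)   ≡⟨ *-distribˡ-sum g rep ⟨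
      g * ∑ rep             ≡⟨ cong (g *_) ∑rep ⟩
      g * (k * k)           ∎
      where open ≤-Reasoning

    energy-bound-odd : ¬ 2 ∣ g → E ≤ (g ∸ 1) * (k * k) + g * k
    energy-bound-odd g-odd = begin
      E   ≤⟨ ∑-mono-≤ (λ x → odd-pointwise g (rep x) (sq x) (below (repr x)) (rep≤g x) (rep-parity x) g-odd) ⟩
      ∑ (λ x → (g ∸ 1) * rep x + g * sq x)
          ≡⟨ ∑-distrib-+ (λ x → (g ∸ 1) * rep x) (λ x → g * sq x) ⟩
      ∑ (λ x → (g ∸ 1) * rep x) + ∑ (λ x → g * sq x)
          ≡⟨ cong₂ _+_ (*-distribˡ-sum (g ∸ 1) rep) (*-distribˡ-sum g sq) ⟨
      (g ∸ 1) * ∑ rep + g * ∑ sq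
          ≡⟨ cong₂ _+_ (cong ((g ∸ 1) *_) ∑rep) (cong (g *_) ∑sq) ⟩
      (g ∸ 1) * (k * k) + g * k ∎
      where open ≤-Reasoning

corollary1 : ∀ {q : ℕ} (G : FiniteAbelianGroup q) (g : ℕ) (A : Subset q) →
    IsSidon G g A →
    ((2 ≤ g → 2 ∣ g → (∣ A ∣ ∸ 1) ^ 2 ≤ (g ∸ 1) * q)
    × (3 ≤ g → ¬ (2 ∣ g) →
        ((2 * (g ∸ 2)) * ∣ A ∣ ∸ (3 * g ∸ 4)) ^ 2
          ≤ (2 * (g ∸ 2)) * (2 * (g ∸ 2)) * (g ∸ 2) * q))
corollary1 {q} G g A sidon = even , odd
  where
  open Energy G A
  ∣A∣≡k : ∣ A ∣ ≡ k
  ∣A∣≡k = ∣∣≡∑χ A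
  T-bound : ∀ {B} → E ≤ k * k + B → T ≤ B
  T-bound E≤ = +-cancelˡ-≤ (k * k) T _ (≤-trans (≤-reflexive k²+T≡E) E≤)
  even : 2 ≤ g → 2 ∣ g → (∣ A ∣ ∸ 1) ^ 2 ≤ (g ∸ 1) * q
  even (s≤s {n = g′} _) _ rewrite ∣A∣≡k = even-arith {k} {S} {T} {q} g′ k+S≡k² S²≤qT (T-bound (energy-bound sidon))
  odd : 3 ≤ g → ¬ 2 ∣ g →
    ((2 * (g ∸ 2)) * ∣ A ∣ ∸ (3 * g ∸ 4)) ^ 2 ≤ (2 * (g ∸ 2)) * (2 * (g ∸ 2)) * (g ∸ 2) * q
  odd (s≤s (s≤s {n = h} _)) g-odd rewrite ∣A∣≡k | 3[2+h]∸4≡2+3h h =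
    odd-arith {k} {S} {T} {q} h k+S≡k² S²≤qT (T-bound (≤-trans (energy-bound-odd sidon g-odd) (≤-reflexive (+-assoc (k * k) _ _))))
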